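{- Let $p$ be a prime, $a\in\mathbb{Z}$ and $m$ a positive integer. Let $\delta_p(a,m)=1$ if $p\mid a$ and $\log_p m$ is a positive integer, and $\delta_p(a,m)=0$ otherwise. Then for every $k=m+(p-1)p^{\lfloor\log_p m\rfloor-\delta_p(a,m)}q$ with $q\in\{0,1,2,\ldots\}$, we have $$\sum_{j=0}^{k}\binom{k}{j}S(j,m)a^{k-j}\equiv 1\pmod p.$$
   Context: $S(j,m)$ denotes the Stirling number of the second kind: for $j+m>0$ it is the number of ways to partition a set of $j$ elements into $m$ nonempty subsets, and $S(0,0)=1$. The convention $0^0=1$ is used. -}

module Defs where

open import Data.Nat as ℕ using (ℕ; zero; suc; _∸_; _^_; _≤?_)
open import Data.Nat.Divisibility using (_∣?_)
open import Data.Nat.Combinatorics using (_C_)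
open import Data.Integer as ℤ using (ℤ; +_; ∣_∣)
open import Data.List using (List; map; foldr; upTo)
open import Relation.Nullary using (yes; no)

S : ℕ → ℕ → ℕ
S zero    zero    = 1
S zero    (suc m) = 0
S (suc j) zero    = 0
S (suc j) (suc m) = suc m ℕ.* S j (suc m) ℕ.+ S j m

sumUpTo : ℕ → (ℕ → ℤ) → ℤ
sumUpTo k f = foldr ℤ._+_ (+ 0) (map f (upTo (suc k)))

-- Σ_{j=0}^{k} C(k,j) S(j,m) a^(k-j)   (ℤ._^_ satisfies a ^ 0 = 1, so 0^0 = 1)
stirlingSum : ℤ → ℕ → ℕ → ℤ
stirlingSum a m k = sumUpTo k (λ j → + (k C j) ℤ.* + S j m ℤ.* a ℤ.^ (k ∸ j))

-- δ_p(a,m), given e = ⌊log_p m⌋:  1 if p ∣ a and log_p m is a positive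
-- integer (i.e. m = p^e with e ≥ 1), else 0.
δ : ℕ → ℤ → ℕ → ℕ → ℕ
δ p a m e with p ∣? ∣ a ∣ | m ℕ.≟ p ^ e | 1 ≤? e
... | yes _ | yes _ | yes _ = 1
... | _     | _     | _     = 0

module Submission where

-- Write U n for the sum at k = m + n. The binomial-transform recurrence shows that U is the
-- coefficient sequence of 1 / ∏_{i ≤ m} (1 - (a + i) X). Modulo p, the product of 1 - (b + i) X
-- over p consecutive i is 1 - X^(p-1): the r-Stirling numbers satisfy
-- (p-1)! T(b, p-1, k) = Δ^(p-1) (y ↦ y^k) (b), which is periodic in k by Fermat. By Frobenius,
-- over p^(f+1) consecutive i the product is 1 - X^N with N = (p-1) p^f. Taking p^(f+1) > m,
-- (1 - X^N) · U is congruent to the product of 1 - (a + i) X over m < i < p^(f+1), a polynomial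
-- whose degree is the number of those a + i prime to p. That number is below N, because one of
-- a, a + 1 is prime to p (when δ = 1, the factor 1 - a X ≡ 1 is dropped and f = e - 1 suffices).
-- A polynomial of degree < N divided by 1 - X^N has equal coefficients at 0, N, 2N, …, all 1.

open import Defs
open import Data.Nat as ℕ using (ℕ; zero; suc; _∸_; _^_; _≤_; _<_; z≤n; s≤s; z<s; s<s; _!)
open import Data.Nat.Primality using (Prime; euclidsLemma; ¬prime[0]; ¬prime[1])
open import Data.Integer as ℤ using (ℤ; +_; -_; _+_; _*_; _-_; -1ℤ)

import Data.Nat.Properties as ℕₚ
import Data.Integer.Properties as ℤₚ
open import Data.Nat.Combinatorics
  using (_C_; nCk+nC[k+1]≡[n+1]C[k+1]; k>n⇒nCk≡0; nCn≡1; nCk≡n!/k![n-k]!; k![n∸k]!∣n!)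
open import Data.Nat.DivMod using (m/n*n≡m)
open import Data.Integer.DivMod using (_%ℕ_; _/ℕ_; a≡a%ℕn+[a/ℕn]*n)
import Data.Integer.Divisibility.Signed as Signed
open import Data.Integer.Tactic.RingSolver using (solve-∀)
import Data.Nat.Tactic.RingSolver as ℕ-Solver
open import Data.List using (map; foldr; applyUpTo)
open import Data.Empty using (⊥-elim)
open import Data.Sum using (inj₁; inj₂)
open import Data.Product using (_,_; _×_; ∃-syntax)
open import Function using (_∘_; id)
import Function.Endo.Propositional as Endo
import Algebra.Properties.Monoid.Mult as MonoidMult
open import Level using (0ℓ)
open import Relation.Nullary using (¬_; yes; no)
open import Relation.Binary.Core using (_Preserves_⟶_)
open import Relation.Binary.Bundles using (Setoid)
import Relation.Binary.Reasoning.Setoid as SetoidReasoning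
open import Relation.Binary.PropositionalEquality

infixr 8 _^∘_
_^∘_ : ∀ {A : Set} → (A → A) → ℕ → A → A
_^∘_ {A} = Endo._^_ A

^∘-* : ∀ {A : Set} (f : A → A) m n → (f ^∘ n) ^∘ m ≡ f ^∘ (m ℕ.* n)
^∘-* {A} f = MonoidMult.×-assocˡ (Endo.∘-id-monoid A) f

^∘-suc : ∀ {A : Set} (f : A → A) k w → (f ^∘ suc k) w ≡ (f ^∘ k) (f w)
^∘-suc f zero    w = refl
^∘-suc f (suc k) w = cong f (^∘-suc f k w)

-- Finite sums and binomial sums

∑ : ℕ → (ℕ → ℤ) → ℤ
∑ zero    f = + 0
∑ (suc n) f = f 0 + ∑ n (f ∘ suc)

foldr-map-applyUpTo : ∀ n g (f : ℕ → ℤ) → foldr _+_ (+ 0) (map f (applyUpTo g n)) ≡ ∑ n (f ∘ g)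
foldr-map-applyUpTo zero    g f = refl
foldr-map-applyUpTo (suc n) g f = cong (_+_ (f (g 0))) (foldr-map-applyUpTo n (g ∘ suc) f)

sumUpTo≡∑ : ∀ k f → sumUpTo k f ≡ ∑ (suc k) f
sumUpTo≡∑ k = foldr-map-applyUpTo (suc k) id

∑-cong : ∀ n {f g : ℕ → ℤ} → (∀ {i} → i < n → f i ≡ g i) → ∑ n f ≡ ∑ n g
∑-cong zero    f≡g = refl
∑-cong (suc n) f≡g = cong₂ _+_ (f≡g z<s) (∑-cong n (f≡g ∘ s<s))

∑-+ : ∀ n f g → ∑ n (λ i → f i + g i) ≡ ∑ n f + ∑ n g
∑-+ zero    f g = refl
∑-+ (suc n) f g =
  trans (cong (_+_ (f 0 + g 0)) (∑-+ n (f ∘ suc) (g ∘ suc)))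
        (interchange (f 0) (g 0) (∑ n (f ∘ suc)) (∑ n (g ∘ suc)))
  where
  interchange : ∀ a b c d → (a + b) + (c + d) ≡ (a + c) + (b + d)
  interchange = solve-∀

∑-*ˡ : ∀ n c f → ∑ n (λ i → c * f i) ≡ c * ∑ n f
∑-*ˡ zero    c f = sym (ℤₚ.*-zeroʳ c)
∑-*ˡ (suc n) c f = trans (cong (_+_ (c * f 0)) (∑-*ˡ n c (f ∘ suc))) (sym (ℤₚ.*-distribˡ-+ c (f 0) _))

∑-extend : ∀ n f → f n ≡ + 0 → ∑ (suc n) f ≡ ∑ n f
∑-extend zero    f f0≡0 = cong (_+ + 0) f0≡0
∑-extend (suc n) f fn≡0 = cong (_+_ (f 0)) (∑-extend n (f ∘ suc) fn≡0)

∑-last : ∀ n f → ∑ (suc n) f ≡ ∑ n f + f n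
∑-last zero    f = trans (ℤₚ.+-identityʳ (f 0)) (sym (ℤₚ.+-identityˡ (f 0)))
∑-last (suc n) f =
  trans (cong (_+_ (f 0)) (∑-last n (f ∘ suc))) (sym (ℤₚ.+-assoc (f 0) (∑ n (f ∘ suc)) (f (suc n))))

binomialSum : ℤ → (ℕ → ℤ) → ℕ → ℤ
binomialSum a s k = ∑ (suc k) λ j → + (k C j) * s j * a ℤ.^ (k ∸ j)

binomialSum-zero : ∀ a s → binomialSum a s 0 ≡ s 0
binomialSum-zero a s = simplify (s 0)
  where
  simplify : ∀ x → + 1 * x * + 1 + + 0 ≡ x
  simplify = solve-∀

a*binomialSum : ∀ a (s : ℕ → ℤ) k → a * binomialSum a s k ≡
  + 1 * s 0 * a ℤ.^ suc k + ∑ (suc k) (λ j → + (k C suc j) * s (suc j) * a ℤ.^ (k ∸ j))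
a*binomialSum a s k = begin
  a * binomialSum a s k
    ≡⟨ ∑-*ˡ (suc k) a term ⟨
  a * term 0 + ∑ k (λ j → a * term (suc j))
    ≡⟨ cong₂ _+_ (commute a (+ 1 * s 0) (a ℤ.^ k)) (∑-cong k a*term≡t) ⟩
  + 1 * s 0 * a ℤ.^ suc k + ∑ k t
    ≡⟨ cong (_+_ (+ 1 * s 0 * a ℤ.^ suc k)) (∑-extend k t t[k]≡0) ⟨
  + 1 * s 0 * a ℤ.^ suc k + ∑ (suc k) t ∎
  where
  open ≡-Reasoning
  term t : ℕ → ℤ
  term j = + (k C j) * s j * a ℤ.^ (k ∸ j)
  t j = + (k C suc j) * s (suc j) * a ℤ.^ (k ∸ j)
  commute : ∀ a x y → a * (x * y) ≡ x * (a * y)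
  commute = solve-∀
  t[k]≡0 : t k ≡ + 0
  t[k]≡0 rewrite k>n⇒nCk≡0 (ℕₚ.n<1+n k) = refl
  a*term≡t : ∀ {j} → j < k → a * term (suc j) ≡ t j
  a*term≡t {j} j<k = begin
    a * (+ (k C suc j) * s (suc j) * a ℤ.^ (k ∸ suc j))
      ≡⟨ commute a (+ (k C suc j) * s (suc j)) (a ℤ.^ (k ∸ suc j)) ⟩
    + (k C suc j) * s (suc j) * a ℤ.^ suc (k ∸ suc j)
      ≡⟨ cong (λ n → + (k C suc j) * s (suc j) * a ℤ.^ n) (ℕₚ.+-∸-assoc 1 j<k) ⟨
    t j ∎

binomialSum-pascal : ∀ a (s : ℕ → ℤ) k →
  ∑ (suc k) (λ j → + (suc k C suc j) * s (suc j) * a ℤ.^ (k ∸ j)) ≡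
  ∑ (suc k) (λ j → + (k C suc j) * s (suc j) * a ℤ.^ (k ∸ j)) + binomialSum a (s ∘ suc) k
binomialSum-pascal a s k =
  trans (∑-cong (suc k) λ {j} _ → pascal j)
        (∑-+ (suc k) (λ j → + (k C suc j) * s (suc j) * a ℤ.^ (k ∸ j))
                     (λ j → + (k C j) * s (suc j) * a ℤ.^ (k ∸ j)))
  where
  distrib : ∀ x y u v → (x + y) * u * v ≡ y * u * v + x * u * v
  distrib = solve-∀
  pascal : ∀ j → + (suc k C suc j) * s (suc j) * a ℤ.^ (k ∸ j) ≡
                 + (k C suc j) * s (suc j) * a ℤ.^ (k ∸ j) + + (k C j) * s (suc j) * a ℤ.^ (k ∸ j)
  pascal j = begin
    + (suc k C suc j) * s (suc j) * a ℤ.^ (k ∸ j)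
      ≡⟨ cong (λ n → + n * s (suc j) * a ℤ.^ (k ∸ j)) (nCk+nC[k+1]≡[n+1]C[k+1] k j) ⟨
    + (k C j ℕ.+ k C suc j) * s (suc j) * a ℤ.^ (k ∸ j)
      ≡⟨ cong (λ n → n * s (suc j) * a ℤ.^ (k ∸ j)) (ℤₚ.pos-+ (k C j) (k C suc j)) ⟩
    (+ (k C j) + + (k C suc j)) * s (suc j) * a ℤ.^ (k ∸ j)
      ≡⟨ distrib (+ (k C j)) (+ (k C suc j)) (s (suc j)) (a ℤ.^ (k ∸ j)) ⟩
    + (k C suc j) * s (suc j) * a ℤ.^ (k ∸ j) + + (k C j) * s (suc j) * a ℤ.^ (k ∸ j) ∎
    where open ≡-Reasoning

binomialSum-suc : ∀ a s k → binomialSum a s (suc k) ≡ a * binomialSum a s k + binomialSum a (s ∘ suc) k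
binomialSum-suc a s k = begin
  + 1 * s 0 * a ℤ.^ suc k + ∑ (suc k) (λ j → + (suc k C suc j) * s (suc j) * a ℤ.^ (k ∸ j))
    ≡⟨ cong (_+_ (+ 1 * s 0 * a ℤ.^ suc k)) (binomialSum-pascal a s k) ⟩
  + 1 * s 0 * a ℤ.^ suc k + (∑ (suc k) t + binomialSum a (s ∘ suc) k)
    ≡⟨ ℤₚ.+-assoc (+ 1 * s 0 * a ℤ.^ suc k) (∑ (suc k) t) (binomialSum a (s ∘ suc) k) ⟨
  + 1 * s 0 * a ℤ.^ suc k + ∑ (suc k) t + binomialSum a (s ∘ suc) k
    ≡⟨ cong (_+ binomialSum a (s ∘ suc) k) (a*binomialSum a s k) ⟨
  a * binomialSum a s k + binomialSum a (s ∘ suc) k ∎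
  where
  open ≡-Reasoning
  t : ℕ → ℤ
  t j = + (k C suc j) * s (suc j) * a ℤ.^ (k ∸ j)

binomialSum-cong : ∀ a k {s t : ℕ → ℤ} → (∀ j → s j ≡ t j) → binomialSum a s k ≡ binomialSum a t k
binomialSum-cong a k s≡t = ∑-cong (suc k) λ {j} _ → cong (λ x → + (k C j) * x * a ℤ.^ (k ∸ j)) (s≡t j)

binomialSum-+ : ∀ a s t k → binomialSum a (λ j → s j + t j) k ≡ binomialSum a s k + binomialSum a t k
binomialSum-+ a s t k =
  trans (∑-cong (suc k) λ {j} _ → distrib (+ (k C j)) (s j) (t j) (a ℤ.^ (k ∸ j)))
        (∑-+ (suc k) (λ j → + (k C j) * s j * a ℤ.^ (k ∸ j)) (λ j → + (k C j) * t j * a ℤ.^ (k ∸ j)))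
  where
  distrib : ∀ c x y z → c * (x + y) * z ≡ c * x * z + c * y * z
  distrib = solve-∀

binomialSum-*ˡ : ∀ a c s k → binomialSum a (λ j → c * s j) k ≡ c * binomialSum a s k
binomialSum-*ˡ a c s k =
  trans (∑-cong (suc k) λ {j} _ → commute (+ (k C j)) c (s j) (a ℤ.^ (k ∸ j)))
        (∑-*ˡ (suc k) c (λ j → + (k C j) * s j * a ℤ.^ (k ∸ j)))
  where
  commute : ∀ b c x z → b * (c * x) * z ≡ c * (b * x * z)
  commute = solve-∀

binomialSum-1 : ∀ x k → binomialSum x (λ _ → + 1) k ≡ (x + + 1) ℤ.^ k
binomialSum-1 x zero    = binomialSum-zero x (λ _ → + 1)
binomialSum-1 x (suc k) = begin
  binomialSum x (λ _ → + 1) (suc k)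
    ≡⟨ binomialSum-suc x (λ _ → + 1) k ⟩
  x * binomialSum x (λ _ → + 1) k + binomialSum x (λ _ → + 1) k
    ≡⟨ cong (λ y → x * y + y) (binomialSum-1 x k) ⟩
  x * (x + + 1) ℤ.^ k + (x + + 1) ℤ.^ k
    ≡⟨ factor x ((x + + 1) ℤ.^ k) ⟩
  (x + + 1) ℤ.^ suc k ∎
  where
  open ≡-Reasoning
  factor : ∀ x y → x * y + y ≡ (x + + 1) * y
  factor = solve-∀

-- r-Stirling numbers

-- For r ∈ ℕ, rStirling r m k is the r-Stirling number {k + r brace m + r}_r.
rStirling : ℤ → ℕ → ℕ → ℤ
rStirling r zero    zero    = + 1
rStirling r (suc m) zero    = + 0
rStirling r zero    (suc k) = r * rStirling r zero k
rStirling r (suc m) (suc k) = rStirling r m k + (r + + suc m) * rStirling r (suc m) k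

rStirling-below : ∀ r {m k} → k < m → rStirling r m k ≡ + 0
rStirling-below r {suc m} {zero}  _         = refl
rStirling-below r {suc m} {suc k} (s<s k<m) = begin
  rStirling r m k + (r + + suc m) * rStirling r (suc m) k
    ≡⟨ cong₂ (λ x y → x + (r + + suc m) * y) (rStirling-below r k<m) (rStirling-below r (ℕₚ.m<n⇒m<1+n k<m)) ⟩
  + 0 + (r + + suc m) * + 0
    ≡⟨ cong (_+_ (+ 0)) (ℤₚ.*-zeroʳ (r + + suc m)) ⟩
  + 0 ∎
  where open ≡-Reasoning

rStirling-diag : ∀ r m → rStirling r m m ≡ + 1
rStirling-diag r zero    = refl
rStirling-diag r (suc m) = begin
  rStirling r m m + (r + + suc m) * rStirling r (suc m) m
    ≡⟨ cong₂ (λ x y → x + (r + + suc m) * y) (rStirling-diag r m) (rStirling-below r (ℕₚ.n<1+n m)) ⟩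
  + 1 + (r + + suc m) * + 0
    ≡⟨ cong (_+_ (+ 1)) (ℤₚ.*-zeroʳ (r + + suc m)) ⟩
  + 1 ∎
  where open ≡-Reasoning

binomialSum-S-suc : ∀ a m k → binomialSum a (λ j → + S (suc j) (suc m)) k ≡
  + suc m * binomialSum a (λ j → + S j (suc m)) k + binomialSum a (λ j → + S j m) k
binomialSum-S-suc a m k = begin
  binomialSum a (λ j → + S (suc j) (suc m)) k
    ≡⟨ binomialSum-cong a k S-suc ⟩
  binomialSum a (λ j → + suc m * + S j (suc m) + + S j m) k
    ≡⟨ binomialSum-+ a (λ j → + suc m * + S j (suc m)) (λ j → + S j m) k ⟩
  binomialSum a (λ j → + suc m * + S j (suc m)) k + binomialSum a (λ j → + S j m) k
    ≡⟨ cong (_+ binomialSum a (λ j → + S j m) k) (binomialSum-*ˡ a (+ suc m) (λ j → + S j (suc m)) k) ⟩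
  + suc m * binomialSum a (λ j → + S j (suc m)) k + binomialSum a (λ j → + S j m) k ∎
  where
  open ≡-Reasoning
  S-suc : ∀ j → + S (suc j) (suc m) ≡ + suc m * + S j (suc m) + + S j m
  S-suc j = trans (ℤₚ.pos-+ (suc m ℕ.* S j (suc m)) (S j m)) (cong (_+ + S j m) (ℤₚ.pos-* (suc m) (S j (suc m))))

binomialSum-stirling : ∀ a m k → binomialSum a (λ j → + S j m) k ≡ rStirling a m k
binomialSum-stirling a zero    zero    = binomialSum-zero a (λ j → + S j 0)
binomialSum-stirling a (suc m) zero    = binomialSum-zero a (λ j → + S j (suc m))
binomialSum-stirling a zero    (suc k) = begin
  binomialSum a (λ j → + S j 0) (suc k)
    ≡⟨ binomialSum-suc a (λ j → + S j 0) k ⟩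
  a * binomialSum a (λ j → + S j 0) k + binomialSum a (λ _ → + 0) k
    ≡⟨ cong₂ _+_ (cong (a *_) (binomialSum-stirling a 0 k)) (binomialSum-*ˡ a (+ 0) (λ _ → + 0) k) ⟩
  a * rStirling a 0 k + + 0
    ≡⟨ ℤₚ.+-identityʳ (a * rStirling a 0 k) ⟩
  rStirling a 0 (suc k) ∎
  where open ≡-Reasoning
binomialSum-stirling a (suc m) (suc k) = begin
  binomialSum a (λ j → + S j (suc m)) (suc k)
    ≡⟨ binomialSum-suc a (λ j → + S j (suc m)) k ⟩
  a * binomialSum a (λ j → + S j (suc m)) k + binomialSum a (λ j → + S (suc j) (suc m)) k
    ≡⟨ cong (_+_ (a * binomialSum a (λ j → + S j (suc m)) k)) (binomialSum-S-suc a m k) ⟩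
  a * binomialSum a (λ j → + S j (suc m)) k
    + (+ suc m * binomialSum a (λ j → + S j (suc m)) k + binomialSum a (λ j → + S j m) k)
    ≡⟨ cong₂ (λ x y → a * x + (+ suc m * x + y)) (binomialSum-stirling a (suc m) k) (binomialSum-stirling a m k) ⟩
  a * rStirling a (suc m) k + (+ suc m * rStirling a (suc m) k + rStirling a m k)
    ≡⟨ collect a (+ suc m) (rStirling a (suc m) k) (rStirling a m k) ⟩
  rStirling a (suc m) (suc k) ∎
  where
  open ≡-Reasoning
  collect : ∀ a b x y → a * x + (b * x + y) ≡ y + (a + b) * x
  collect = solve-∀

stirlingSum≡rStirling : ∀ a m k → stirlingSum a m k ≡ rStirling a m k
stirlingSum≡rStirling a m k =
  trans (sumUpTo≡∑ k (λ j → + (k C j) * + S j m * a ℤ.^ (k ∸ j))) (binomialSum-stirling a m k)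

rStirling-zero : ∀ r k → rStirling r 0 k ≡ r ℤ.^ k
rStirling-zero r zero    = refl
rStirling-zero r (suc k) = cong (r *_) (rStirling-zero r k)

Δ : (ℤ → ℤ) → ℤ → ℤ
Δ g x = g (x + + 1) - g x

Δ^∘-const : ∀ m c x → (Δ ^∘ suc m) (λ _ → c) x ≡ + 0
Δ^∘-const zero    c x = ℤₚ.+-inverseʳ c
Δ^∘-const (suc m) c x = cong₂ _-_ (Δ^∘-const m c (x + + 1)) (Δ^∘-const m c x)

Δ^∘-leibniz : ∀ n g x →
  (Δ ^∘ suc n) (λ y → y * g y) x ≡ x * (Δ ^∘ suc n) g x + + suc n * (Δ ^∘ n) g (x + + 1)
Δ^∘-leibniz zero    g x = base x (g (x + + 1)) (g x)
  where
  base : ∀ x a b → (x + + 1) * a - x * b ≡ x * (a - b) + + 1 * a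
  base = solve-∀
Δ^∘-leibniz (suc n) g x = begin
  (Δ ^∘ suc n) (λ y → y * g y) (x + + 1) - (Δ ^∘ suc n) (λ y → y * g y) x
    ≡⟨ cong₂ _-_ (Δ^∘-leibniz n g (x + + 1)) (Δ^∘-leibniz n g x) ⟩
  ((x + + 1) * (D (x + + 1 + + 1) - D (x + + 1)) + + suc n * D (x + + 1 + + 1))
    - (x * (Δ ^∘ suc n) g x + + suc n * D (x + + 1))
    ≡⟨ step x (D (x + + 1 + + 1)) (D (x + + 1)) ((Δ ^∘ suc n) g x) (+ suc n) ⟩
  x * ((D (x + + 1 + + 1) - D (x + + 1)) - (Δ ^∘ suc n) g x) + (+ 1 + + suc n) * (D (x + + 1 + + 1) - D (x + + 1))
    ≡⟨ cong (λ c → x * (Δ ^∘ suc (suc n)) g x + c * (Δ ^∘ suc n) g (x + + 1)) (ℤₚ.pos-+ 1 (suc n)) ⟨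
  x * (Δ ^∘ suc (suc n)) g x + + suc (suc n) * (Δ ^∘ suc n) g (x + + 1) ∎
  where
  open ≡-Reasoning
  D : ℤ → ℤ
  D = (Δ ^∘ n) g
  step : ∀ x a b c s → ((x + + 1) * (a - b) + s * a) - (x * c + s * b) ≡ x * ((a - b) - c) + (+ 1 + s) * (a - b)
  step = solve-∀

rStirling-Δ : ∀ b m k → + (m !) * rStirling b m k ≡ (Δ ^∘ m) (ℤ._^ k) b
rStirling-Δ b zero    k       = trans (ℤₚ.*-identityˡ (rStirling b 0 k)) (rStirling-zero b k)
rStirling-Δ b (suc m) zero    = trans (ℤₚ.*-zeroʳ (+ (suc m !))) (sym (Δ^∘-const m (+ 1) b))
rStirling-Δ b (suc m) (suc k) = begin
  + (suc m !) * (rStirling b m k + (b + + suc m) * rStirling b (suc m) k)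
    ≡⟨ cong (_* (rStirling b m k + (b + + suc m) * rStirling b (suc m) k)) (ℤₚ.pos-* (suc m) (m !)) ⟩
  + suc m * + (m !) * (rStirling b m k + (b + + suc m) * rStirling b (suc m) k)
    ≡⟨ distribute (+ suc m) (+ (m !)) (rStirling b m k) b (rStirling b (suc m) k) ⟩
  + suc m * (+ (m !) * rStirling b m k) + (b + + suc m) * (+ suc m * + (m !) * rStirling b (suc m) k)
    ≡⟨ cong (λ c → + suc m * (+ (m !) * rStirling b m k) + (b + + suc m) * (c * rStirling b (suc m) k))
            (ℤₚ.pos-* (suc m) (m !)) ⟨
  + suc m * (+ (m !) * rStirling b m k) + (b + + suc m) * (+ (suc m !) * rStirling b (suc m) k)
    ≡⟨ cong₂ (λ u v → + suc m * u + (b + + suc m) * v) (rStirling-Δ b m k) (rStirling-Δ b (suc m) k) ⟩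
  + suc m * D b + (b + + suc m) * (D (b + + 1) - D b)
    ≡⟨ regroup (+ suc m) (D b) (D (b + + 1)) b ⟩
  b * (D (b + + 1) - D b) + + suc m * D (b + + 1)
    ≡⟨ Δ^∘-leibniz m (ℤ._^ k) b ⟨
  (Δ ^∘ suc m) (ℤ._^ suc k) b ∎
  where
  open ≡-Reasoning
  D : ℤ → ℤ
  D = (Δ ^∘ m) (ℤ._^ k)
  distribute : ∀ s f t b t′ → s * f * (t + (b + s) * t′) ≡ s * (f * t) + (b + s) * (s * f * t′)
  distribute = solve-∀
  regroup : ∀ s d₀ d₁ b → s * d₀ + (b + s) * (d₁ - d₀) ≡ b * (d₁ - d₀) + s * d₁
  regroup = solve-∀

-- Power series as coefficient sequences

-- A sequence w stands for the power series Σ w n Xⁿ; the operators below multiply or divide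
-- by the polynomial written in their name.
Seq : Set
Seq = ℕ → ℤ

one : Seq
one zero    = + 1
one (suc n) = + 0

shift : Seq → Seq
shift w zero    = + 0
shift w (suc n) = w n

[1+_·X^_] : ℤ → ℕ → Seq → Seq
[1+ c ·X^ d ] w n = w n + c * (shift ^∘ d) w n

[1-_·X] : ℤ → Seq → Seq
[1- r ·X] = [1+ - r ·X^ 1 ]

[1-_·X]⁻¹ : ℤ → Seq → Seq
[1- r ·X]⁻¹ w zero    = w zero
[1- r ·X]⁻¹ w (suc n) = w (suc n) + r * [1- r ·X]⁻¹ w n

[1-X^_] : ℕ → Seq → Seq
[1-X^ d ] = [1+ -1ℤ ·X^ d ]

mulRising divRising : ℤ → ℕ → Seq → Seq
mulRising b zero    = id
mulRising b (suc k) = [1- b + + k ·X] ∘ mulRising b k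
divRising b zero    = id
divRising b (suc k) = [1- b + + k ·X]⁻¹ ∘ divRising b k

shift^∘-+ : ∀ d w n → (shift ^∘ d) w (d ℕ.+ n) ≡ w n
shift^∘-+ zero    w n = refl
shift^∘-+ (suc d) w n = shift^∘-+ d w n

shift^∘-below : ∀ {d n} w → n < d → (shift ^∘ d) w n ≡ + 0
shift^∘-below {suc d} {zero}  w _         = refl
shift^∘-below {suc d} {suc n} w (s<s n<d) = shift^∘-below w n<d

-- The ℤ[X]-linear maps; they commute with all the operators above.
record IsXLinear (F : Seq → Seq) : Set where
  field
    ≗-cong     : ∀ {u v} → u ≗ v → F u ≗ F v
    linear     : ∀ u v c → F (λ n → u n + c * v n) ≗ λ n → F u n + c * F v n
    shift-comm : ∀ u → F (shift u) ≗ shift (F u)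
open IsXLinear

id-isXLinear : IsXLinear id
id-isXLinear = record { ≗-cong = id ; linear = λ _ _ _ _ → refl ; shift-comm = λ _ _ → refl }

∘-isXLinear : ∀ {F G} → IsXLinear F → IsXLinear G → IsXLinear (F ∘ G)
∘-isXLinear {F} {G} F-lin G-lin = record
  { ≗-cong     = ≗-cong F-lin ∘ ≗-cong G-lin
  ; linear     = λ u v c n → trans (≗-cong F-lin (linear G-lin u v c) n) (linear F-lin (G u) (G v) c n)
  ; shift-comm = λ u n → trans (≗-cong F-lin (shift-comm G-lin u) n) (shift-comm F-lin (G u) n)
  }

^∘-isXLinear : ∀ {F} → IsXLinear F → ∀ k → IsXLinear (F ^∘ k)
^∘-isXLinear F-lin zero    = id-isXLinear
^∘-isXLinear F-lin (suc k) = ∘-isXLinear F-lin (^∘-isXLinear F-lin k)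

shift-isXLinear : IsXLinear shift
shift-isXLinear = record { ≗-cong = ≗-cong′ ; linear = linear′ ; shift-comm = λ _ _ → refl }
  where
  ≗-cong′ : ∀ {u v} → u ≗ v → shift u ≗ shift v
  ≗-cong′ u≗v zero    = refl
  ≗-cong′ u≗v (suc n) = u≗v n
  linear′ : ∀ u v c → shift (λ n → u n + c * v n) ≗ λ n → shift u n + c * shift v n
  linear′ u v c zero    = cong (_+_ (+ 0)) (sym (ℤₚ.*-zeroʳ c))
  linear′ u v c (suc n) = refl

[1+·X^]-isXLinear : ∀ c d → IsXLinear [1+ c ·X^ d ]
[1+·X^]-isXLinear c d = record
  { ≗-cong     = λ u≗v n → cong₂ (λ x y → x + c * y) (u≗v n) (≗-cong shift^d-lin u≗v n)
  ; linear     = λ u v a n → trans (cong (λ y → u n + a * v n + c * y) (linear shift^d-lin u v a n))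
                                   (interchange (u n) (v n) a c ((shift ^∘ d) u n) ((shift ^∘ d) v n))
  ; shift-comm = shift-comm′
  }
  where
  shift^d-lin : IsXLinear (shift ^∘ d)
  shift^d-lin = ^∘-isXLinear shift-isXLinear d
  interchange : ∀ x y a c z w → x + a * y + c * (z + a * w) ≡ x + c * z + a * (y + c * w)
  interchange = solve-∀
  shift-comm′ : ∀ u → [1+ c ·X^ d ] (shift u) ≗ shift ([1+ c ·X^ d ] u)
  shift-comm′ u zero    =
    trans (cong (λ y → + 0 + c * y) (shift-comm shift^d-lin u 0)) (cong (_+_ (+ 0)) (ℤₚ.*-zeroʳ c))
  shift-comm′ u (suc n) = cong (λ y → u n + c * y) (shift-comm shift^d-lin u (suc n))

[1-·X]⁻¹-isXLinear : ∀ r → IsXLinear [1- r ·X]⁻¹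
[1-·X]⁻¹-isXLinear r = record { ≗-cong = ≗-cong′ ; linear = linear′ ; shift-comm = shift-comm′ }
  where
  ≗-cong′ : ∀ {u v} → u ≗ v → [1- r ·X]⁻¹ u ≗ [1- r ·X]⁻¹ v
  ≗-cong′ u≗v zero    = u≗v zero
  ≗-cong′ u≗v (suc n) = cong₂ (λ x y → x + r * y) (u≗v (suc n)) (≗-cong′ u≗v n)
  linear′ : ∀ u v c → [1- r ·X]⁻¹ (λ n → u n + c * v n) ≗ λ n → [1- r ·X]⁻¹ u n + c * [1- r ·X]⁻¹ v n
  linear′ u v c zero    = refl
  linear′ u v c (suc n) = trans (cong (λ y → u (suc n) + c * v (suc n) + r * y) (linear′ u v c n))
                                (interchange (u (suc n)) (v (suc n)) c r ([1- r ·X]⁻¹ u n) ([1- r ·X]⁻¹ v n))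
    where
    interchange : ∀ x y c r z w → x + c * y + r * (z + c * w) ≡ x + r * z + c * (y + r * w)
    interchange = solve-∀
  shift-comm′ : ∀ u → [1- r ·X]⁻¹ (shift u) ≗ shift ([1- r ·X]⁻¹ u)
  shift-comm′ u zero          = refl
  shift-comm′ u (suc zero)    = trans (cong (_+_ (u 0)) (ℤₚ.*-zeroʳ r)) (ℤₚ.+-identityʳ (u 0))
  shift-comm′ u (suc (suc n)) = cong (λ y → u (suc n) + r * y) (shift-comm′ u (suc n))

[1-·X]⁻¹-unique : ∀ r w v → v ≗ (λ n → w n + r * shift v n) → v ≗ [1- r ·X]⁻¹ w
[1-·X]⁻¹-unique r w v v-eqn zero    =
  trans (v-eqn zero) (trans (cong (_+_ (w 0)) (ℤₚ.*-zeroʳ r)) (ℤₚ.+-identityʳ (w 0)))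
[1-·X]⁻¹-unique r w v v-eqn (suc n) =
  trans (v-eqn (suc n)) (cong (λ y → w (suc n) + r * y) ([1-·X]⁻¹-unique r w v v-eqn n))

[1-·X]∘[1-·X]⁻¹ : ∀ r w → [1- r ·X] ([1- r ·X]⁻¹ w) ≗ w
[1-·X]∘[1-·X]⁻¹ r w zero    = trans (cong (_+_ (w 0)) (ℤₚ.*-zeroʳ (- r))) (ℤₚ.+-identityʳ (w 0))
[1-·X]∘[1-·X]⁻¹ r w (suc n) = cancel (w (suc n)) r ([1- r ·X]⁻¹ w n)
  where
  cancel : ∀ x r y → x + r * y + - r * y ≡ x
  cancel = solve-∀

module _ {F : Seq → Seq} (F-lin : IsXLinear F) where

  commutes-shift^∘ : ∀ d u → F ((shift ^∘ d) u) ≗ (shift ^∘ d) (F u)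
  commutes-shift^∘ zero    u n = refl
  commutes-shift^∘ (suc d) u n =
    trans (shift-comm F-lin ((shift ^∘ d) u) n) (≗-cong shift-isXLinear (commutes-shift^∘ d u) n)

  commutes-[1+·X^] : ∀ c d u → F ([1+ c ·X^ d ] u) ≗ [1+ c ·X^ d ] (F u)
  commutes-[1+·X^] c d u n =
    trans (linear F-lin u ((shift ^∘ d) u) c n) (cong (λ y → F u n + c * y) (commutes-shift^∘ d u n))

  commutes-[1-·X]⁻¹ : ∀ r u → F ([1- r ·X]⁻¹ u) ≗ [1- r ·X]⁻¹ (F u)
  commutes-[1-·X]⁻¹ r u = [1-·X]⁻¹-unique r (F u) (F ([1- r ·X]⁻¹ u)) λ n → begin
    F ([1- r ·X]⁻¹ u) n
      ≡⟨ ≗-cong F-lin (λ m → sym ([1-·X]⁻¹-eqn m)) n ⟩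
    F (λ m → u m + r * shift ([1- r ·X]⁻¹ u) m) n
      ≡⟨ linear F-lin u (shift ([1- r ·X]⁻¹ u)) r n ⟩
    F u n + r * F (shift ([1- r ·X]⁻¹ u)) n
      ≡⟨ cong (λ y → F u n + r * y) (shift-comm F-lin ([1- r ·X]⁻¹ u) n) ⟩
    F u n + r * shift (F ([1- r ·X]⁻¹ u)) n ∎
    where
    open ≡-Reasoning
    [1-·X]⁻¹-eqn : ∀ m → u m + r * shift ([1- r ·X]⁻¹ u) m ≡ [1- r ·X]⁻¹ u m
    [1-·X]⁻¹-eqn zero    = trans (cong (_+_ (u 0)) (ℤₚ.*-zeroʳ r)) (ℤₚ.+-identityʳ (u 0))
    [1-·X]⁻¹-eqn (suc m) = refl

  commutes-mulRising : ∀ b k u → F (mulRising b k u) ≗ mulRising b k (F u)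
  commutes-mulRising b zero    u n = refl
  commutes-mulRising b (suc k) u n =
    trans (commutes-[1+·X^] (- (b + + k)) 1 (mulRising b k u) n)
          (≗-cong ([1+·X^]-isXLinear (- (b + + k)) 1) (commutes-mulRising b k u) n)

  commutes-divRising : ∀ b k u → F (divRising b k u) ≗ divRising b k (F u)
  commutes-divRising b zero    u n = refl
  commutes-divRising b (suc k) u n =
    trans (commutes-[1-·X]⁻¹ (b + + k) (divRising b k u) n)
          (≗-cong ([1-·X]⁻¹-isXLinear (b + + k)) (commutes-divRising b k u) n)

divRising-isXLinear : ∀ b k → IsXLinear (divRising b k)
divRising-isXLinear b zero    = id-isXLinear
divRising-isXLinear b (suc k) = ∘-isXLinear ([1-·X]⁻¹-isXLinear (b + + k)) (divRising-isXLinear b k)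

[1-0·X]⁻¹-one : [1- + 0 ·X]⁻¹ one ≗ one
[1-0·X]⁻¹-one zero    = refl
[1-0·X]⁻¹-one (suc n) = refl

mulRising∘divRising : ∀ b k w → mulRising b k (divRising b k w) ≗ w
mulRising∘divRising b zero    w n = refl
mulRising∘divRising b (suc k) w n = begin
  [1- r ·X] (mulRising b k ([1- r ·X]⁻¹ (divRising b k w))) n
    ≡⟨ ≗-cong ([1+·X^]-isXLinear (- r) 1) (commutes-mulRising ([1-·X]⁻¹-isXLinear r) b k (divRising b k w)) n ⟨
  [1- r ·X] ([1- r ·X]⁻¹ (mulRising b k (divRising b k w))) n
    ≡⟨ [1-·X]∘[1-·X]⁻¹ r (mulRising b k (divRising b k w)) n ⟩
  mulRising b k (divRising b k w) n
    ≡⟨ mulRising∘divRising b k w n ⟩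
  w n ∎
  where
  open ≡-Reasoning
  r : ℤ
  r = b + + k

divRising-+ : ∀ b k l w → divRising b (k ℕ.+ l) w ≗ divRising (b + + k) l (divRising b k w)
divRising-+ b k zero    w n = cong (λ i → divRising b i w n) (ℕₚ.+-identityʳ k)
divRising-+ b k (suc l) w n = begin
  divRising b (k ℕ.+ suc l) w n
    ≡⟨ cong (λ i → divRising b i w n) (ℕₚ.+-suc k l) ⟩
  [1- b + + (k ℕ.+ l) ·X]⁻¹ (divRising b (k ℕ.+ l) w) n
    ≡⟨ cong (λ r → [1- r ·X]⁻¹ (divRising b (k ℕ.+ l) w) n)
            (trans (cong (_+_ b) (ℤₚ.pos-+ k l)) (sym (ℤₚ.+-assoc b (+ k) (+ l)))) ⟩
  [1- b + + k + + l ·X]⁻¹ (divRising b (k ℕ.+ l) w) n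
    ≡⟨ ≗-cong ([1-·X]⁻¹-isXLinear (b + + k + + l)) (divRising-+ b k l w) n ⟩
  divRising (b + + k) (suc l) (divRising b k w) n ∎
  where open ≡-Reasoning

divRising-head : ∀ b k w → divRising b k w 0 ≡ w 0
divRising-head b zero    w = refl
divRising-head b (suc k) w = divRising-head b k w

divRising-rStirling : ∀ b m n → divRising b (suc m) one n ≡ rStirling b m (m ℕ.+ n)
divRising-rStirling b zero    zero    = refl
divRising-rStirling b zero    (suc n) = begin
  + 0 + (b + + 0) * divRising b 1 one n
    ≡⟨ cong₂ (λ x y → + 0 + x * y) (ℤₚ.+-identityʳ b) (divRising-rStirling b 0 n) ⟩
  + 0 + b * rStirling b 0 n
    ≡⟨ ℤₚ.+-identityˡ (b * rStirling b 0 n) ⟩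
  rStirling b 0 (suc n) ∎
  where open ≡-Reasoning
divRising-rStirling b (suc m) zero    = begin
  divRising b (suc m) one 0
    ≡⟨ divRising-rStirling b m 0 ⟩
  rStirling b m (m ℕ.+ 0)
    ≡⟨ cong (rStirling b m) (ℕₚ.+-identityʳ m) ⟩
  rStirling b m m
    ≡⟨ trans (rStirling-diag b m) (sym (rStirling-diag b (suc m))) ⟩
  rStirling b (suc m) (suc m)
    ≡⟨ cong (rStirling b (suc m)) (ℕₚ.+-identityʳ (suc m)) ⟨
  rStirling b (suc m) (suc m ℕ.+ 0) ∎
  where open ≡-Reasoning
divRising-rStirling b (suc m) (suc n) = begin
  divRising b (suc m) one (suc n) + (b + + suc m) * divRising b (suc (suc m)) one n
    ≡⟨ cong₂ (λ x y → x + (b + + suc m) * y) (divRising-rStirling b m (suc n)) (divRising-rStirling b (suc m) n) ⟩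
  rStirling b m (m ℕ.+ suc n) + (b + + suc m) * rStirling b (suc m) (suc m ℕ.+ n)
    ≡⟨ cong (λ i → rStirling b m (m ℕ.+ suc n) + (b + + suc m) * rStirling b (suc m) i) (ℕₚ.+-suc m n) ⟨
  rStirling b (suc m) (suc m ℕ.+ suc n) ∎
  where open ≡-Reasoning

stirlingSum-divRising : ∀ a m n → stirlingSum a m (m ℕ.+ n) ≡ divRising a (suc m) one n
stirlingSum-divRising a m n = trans (stirlingSum≡rStirling a m (m ℕ.+ n)) (sym (divRising-rStirling a m n))

[1+·X^]^∘-binomial : ∀ c d k w n →
  ([1+ c ·X^ d ] ^∘ k) w n ≡ binomialSum (+ 1) (λ j → c ℤ.^ j * ((shift ^∘ d) ^∘ j) w n) k
[1+·X^]^∘-binomial c d zero    w n =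
  sym (trans (binomialSum-zero (+ 1) (λ j → c ℤ.^ j * ((shift ^∘ d) ^∘ j) w n)) (ℤₚ.*-identityˡ (w n)))
[1+·X^]^∘-binomial c d (suc k) w n = begin
  ([1+ c ·X^ d ] ^∘ suc k) w n
    ≡⟨ cong (λ v → v n) (^∘-suc [1+ c ·X^ d ] k w) ⟩
  ([1+ c ·X^ d ] ^∘ k) ([1+ c ·X^ d ] w) n
    ≡⟨ [1+·X^]^∘-binomial c d k ([1+ c ·X^ d ] w) n ⟩
  binomialSum (+ 1) (λ j → c ℤ.^ j * (G ^∘ j) ([1+ c ·X^ d ] w) n) k
    ≡⟨ binomialSum-cong (+ 1) k step ⟩
  binomialSum (+ 1) (λ j → s j + s (suc j)) k
    ≡⟨ binomialSum-+ (+ 1) s (s ∘ suc) k ⟩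
  binomialSum (+ 1) s k + binomialSum (+ 1) (s ∘ suc) k
    ≡⟨ cong (_+ binomialSum (+ 1) (s ∘ suc) k) (ℤₚ.*-identityˡ (binomialSum (+ 1) s k)) ⟨
  + 1 * binomialSum (+ 1) s k + binomialSum (+ 1) (s ∘ suc) k
    ≡⟨ binomialSum-suc (+ 1) s k ⟨
  binomialSum (+ 1) s (suc k) ∎
  where
  open ≡-Reasoning
  G : Seq → Seq
  G = shift ^∘ d
  s : ℕ → ℤ
  s j = c ℤ.^ j * (G ^∘ j) w n
  distrib : ∀ a c x y → a * (x + c * y) ≡ a * x + c * a * y
  distrib = solve-∀
  step : ∀ j → c ℤ.^ j * (G ^∘ j) ([1+ c ·X^ d ] w) n ≡ s j + s (suc j)
  step j = begin
    c ℤ.^ j * (G ^∘ j) ([1+ c ·X^ d ] w) n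
      ≡⟨ cong (c ℤ.^ j *_) (linear (^∘-isXLinear (^∘-isXLinear shift-isXLinear d) j) w (G w) c n) ⟩
    c ℤ.^ j * ((G ^∘ j) w n + c * (G ^∘ j) (G w) n)
      ≡⟨ cong (λ y → c ℤ.^ j * ((G ^∘ j) w n + c * y)) (cong (λ v → v n) (^∘-suc G j w)) ⟨
    c ℤ.^ j * ((G ^∘ j) w n + c * (G ^∘ suc j) w n)
      ≡⟨ distrib (c ℤ.^ j) c ((G ^∘ j) w n) ((G ^∘ suc j) w n) ⟩
    s j + s (suc j) ∎

-- Congruences modulo a prime

-- The prime is written 2 + p-2 so that p ∸ 1 and p ∸ 2 compute.
module _ {p-2 : ℕ} (p-prime : Prime (suc (suc p-2))) where

  open import Data.Nat.Divisibility
    using (_∣_; _∣?_; _∣0; ∣-refl; ∣⇒≤; ∣1⇒≡1; m∣m*n; ∣m∣n⇒∣m+n; ∣m+n∣m⇒∣n)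

  private
    p-1 p : ℕ
    p-1 = suc p-2
    p   = suc p-1

  infix 4 _≈_
  record _≈_ (x y : ℤ) : Set where
    constructor mod-p
    field p∣x-y : + p Signed.∣ x - y

  ≈-from : ∀ {x y d} → + p Signed.∣ d → d ≡ x - y → x ≈ y
  ≈-from p∣d refl = mod-p p∣d

  ≈-refl : ∀ {x} → x ≈ x
  ≈-refl {x} = ≈-from (Signed.divides (+ 0) refl) (sym (ℤₚ.+-inverseʳ x))

  ≡⇒≈ : ∀ {x y} → x ≡ y → x ≈ y
  ≡⇒≈ refl = ≈-refl

  ≈-sym : ∀ {x y} → x ≈ y → y ≈ x
  ≈-sym {x} {y} (mod-p p∣x-y) = ≈-from (Signed.∣m⇒∣-m p∣x-y) (negate x y)
    where
    negate : ∀ x y → - (x - y) ≡ y - x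
    negate = solve-∀

  ≈-trans : ∀ {x y z} → x ≈ y → y ≈ z → x ≈ z
  ≈-trans {x} {y} {z} (mod-p p∣x-y) (mod-p p∣y-z) = ≈-from (Signed.∣m∣n⇒∣m+n p∣x-y p∣y-z) (telescope x y z)
    where
    telescope : ∀ x y z → (x - y) + (y - z) ≡ x - z
    telescope = solve-∀

  ≈-setoid : Setoid 0ℓ 0ℓ
  ≈-setoid = record
    { Carrier       = ℤ
    ; _≈_           = _≈_
    ; isEquivalence = record { refl = ≈-refl ; sym = ≈-sym ; trans = ≈-trans }
    }

  module ≈-Reasoning = SetoidReasoning ≈-setoid

  +-cong : ∀ {x x′ y y′} → x ≈ x′ → y ≈ y′ → x + y ≈ x′ + y′
  +-cong {x} {x′} {y} {y′} (mod-p p∣x-x′) (mod-p p∣y-y′) =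
    ≈-from (Signed.∣m∣n⇒∣m+n p∣x-x′ p∣y-y′) (regroup x x′ y y′)
    where
    regroup : ∀ x x′ y y′ → (x - x′) + (y - y′) ≡ (x + y) - (x′ + y′)
    regroup = solve-∀

  *-cong : ∀ {x x′ y y′} → x ≈ x′ → y ≈ y′ → x * y ≈ x′ * y′
  *-cong {x} {x′} {y} {y′} (mod-p p∣x-x′) (mod-p p∣y-y′) =
    ≈-from (Signed.∣m∣n⇒∣m+n (Signed.∣m⇒∣m*n y p∣x-x′) (Signed.∣n⇒∣m*n x′ p∣y-y′))
           (regroup x x′ y y′)
    where
    regroup : ∀ x x′ y y′ → (x - x′) * y + x′ * (y - y′) ≡ x * y - x′ * y′
    regroup = solve-∀

  -‿cong : ∀ {x y} → x ≈ y → - x ≈ - y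
  -‿cong {x} {y} (mod-p p∣x-y) = ≈-from (Signed.∣m⇒∣-m p∣x-y) (regroup x y)
    where
    regroup : ∀ x y → - (x - y) ≡ - x - - y
    regroup = solve-∀

  ^-cong : ∀ {x y} k → x ≈ y → x ℤ.^ k ≈ y ℤ.^ k
  ^-cong zero    x≈y = ≈-refl
  ^-cong (suc k) x≈y = *-cong x≈y (^-cong k x≈y)

  *-zeroˡ-≈ : ∀ {x} y → x ≈ + 0 → x * y ≈ + 0
  *-zeroˡ-≈ y x≈0 = ≈-trans (*-cong x≈0 (≈-refl {y})) ≈-refl

  ∣⇒≈0 : ∀ {n} → p ∣ n → + n ≈ + 0
  ∣⇒≈0 {n} p∣n = ≈-from (Signed.∣ᵤ⇒∣ p∣n) (sym (ℤₚ.+-identityʳ (+ n)))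

  ≈-%ℕ : ∀ x → x ≈ + (x %ℕ p)
  ≈-%ℕ x = ≈-from (Signed.divides (x /ℕ p) refl) (begin
    x /ℕ p * + p                           ≡⟨ cancel (+ (x %ℕ p)) (x /ℕ p * + p) ⟩
    + (x %ℕ p) + x /ℕ p * + p - + (x %ℕ p) ≡⟨ cong (_- + (x %ℕ p)) (a≡a%ℕn+[a/ℕn]*n x p) ⟨
    x - + (x %ℕ p)                         ∎)
    where
    open ≡-Reasoning
    cancel : ∀ r q → q ≡ r + q - r
    cancel = solve-∀

  p∤! : ∀ {n} → n < p → ¬ p ∣ n !
  p∤! {zero}  _     p∣1 with () ← ∣1⇒≡1 p∣1
  p∤! {suc n} n+1<p p∣n+1! with euclidsLemma (suc n) (n !) p-prime p∣n+1!
  ... | inj₁ p∣n+1 = ℕₚ.<⇒≱ n+1<p (∣⇒≤ p∣n+1)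
  ... | inj₂ p∣n!  = p∤! (ℕₚ.<-trans (ℕₚ.n<1+n n) n+1<p) p∣n!

  p∣pCi : ∀ {i} → 0 < i → i < p → p ∣ p C i
  p∣pCi {i} 0<i i<p with euclidsLemma (p C i) (i ! ℕ.* (p ∸ i) !) p-prime p∣C*i!*[p-i]!
    where
    instance
      i!*[p-i]!≢0 : ℕ.NonZero (i ! ℕ.* (p ∸ i) !)
      i!*[p-i]!≢0 = ℕₚ._!*_!≢0 i (p ∸ i)
    p∣C*i!*[p-i]! : p ∣ (p C i) ℕ.* (i ! ℕ.* (p ∸ i) !)
    p∣C*i!*[p-i]! = subst (p ∣_)
      (sym (trans (cong (ℕ._* (i ! ℕ.* (p ∸ i) !)) (nCk≡n!/k![n-k]! (ℕₚ.<⇒≤ i<p)))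
                  (m/n*n≡m (k![n∸k]!∣n! (ℕₚ.<⇒≤ i<p)))))
      (m∣m*n (p-1 !))
  ... | inj₁ p∣C = p∣C
  ... | inj₂ p∣i!*[p-i]! with euclidsLemma (i !) ((p ∸ i) !) p-prime p∣i!*[p-i]!
  ...   | inj₁ p∣i!     = ⊥-elim (p∤! i<p p∣i!)
  ...   | inj₂ p∣[p-i]! = ⊥-elim (p∤! (ℕₚ.∸-monoʳ-< 0<i (ℕₚ.<⇒≤ i<p)) p∣[p-i]!)

  ∑-≈0 : ∀ n f → (∀ {i} → i < n → f i ≈ + 0) → ∑ n f ≈ + 0
  ∑-≈0 zero    f f≈0 = ≈-refl
  ∑-≈0 (suc n) f f≈0 = +-cong (f≈0 z<s) (∑-≈0 n (f ∘ suc) (f≈0 ∘ s<s))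

  binomialSum-prime : ∀ a s → binomialSum a s p ≈ a ℤ.^ p * s 0 + s p
  binomialSum-prime a s = begin
    term 0 + ∑ p (term ∘ suc)
      ≡⟨ cong (_+_ (term 0)) (∑-last p-1 (term ∘ suc)) ⟩
    term 0 + (∑ p-1 (term ∘ suc) + term p)
      ≈⟨ +-cong (≈-refl {term 0}) (+-cong (∑-≈0 p-1 (term ∘ suc) middle≈0) (≈-refl {term p})) ⟩
    term 0 + (+ 0 + term p)
      ≡⟨ cong₂ _+_ (first (s 0) (a ℤ.^ p)) (trans (ℤₚ.+-identityˡ (term p)) last) ⟩
    a ℤ.^ p * s 0 + s p ∎
    where
    open ≈-Reasoning
    term : ℕ → ℤ
    term j = + (p C j) * s j * a ℤ.^ (p ∸ j)
    middle≈0 : ∀ {i} → i < p-1 → term (suc i) ≈ + 0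
    middle≈0 i<p-1 = *-zeroˡ-≈ _ (*-zeroˡ-≈ (s _) (∣⇒≈0 (p∣pCi z<s (s<s i<p-1))))
    first : ∀ x y → + 1 * x * y ≡ y * x
    first = solve-∀
    last : term p ≡ s p
    last = trans (cong₂ (λ c e → + c * s p * a ℤ.^ e) (nCn≡1 p) (ℕₚ.n∸n≡0 p))
                 (trans (ℤₚ.*-identityʳ (+ 1 * s p)) (ℤₚ.*-identityˡ (s p)))

  [x+1]^p≈x^p+1 : ∀ x → (x + + 1) ℤ.^ p ≈ x ℤ.^ p + + 1
  [x+1]^p≈x^p+1 x = begin
    (x + + 1) ℤ.^ p                    ≡⟨ binomialSum-1 x p ⟨
    binomialSum x (λ _ → + 1) p        ≈⟨ binomialSum-prime x (λ _ → + 1) ⟩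
    x ℤ.^ p * + 1 + + 1                ≡⟨ cong (_+ + 1) (ℤₚ.*-identityʳ (x ℤ.^ p)) ⟩
    x ℤ.^ p + + 1                      ∎
    where open ≈-Reasoning

  fermat-ℕ : ∀ n → (+ n) ℤ.^ p ≈ + n
  fermat-ℕ zero    = ≈-refl
  fermat-ℕ (suc n) = begin
    (+ suc n) ℤ.^ p       ≡⟨ cong (ℤ._^ p) 1+n≡n+1 ⟩
    (+ n + + 1) ℤ.^ p     ≈⟨ [x+1]^p≈x^p+1 (+ n) ⟩
    (+ n) ℤ.^ p + + 1     ≈⟨ +-cong (fermat-ℕ n) (≈-refl {+ 1}) ⟩
    + n + + 1             ≡⟨ 1+n≡n+1 ⟨
    + suc n               ∎
    where
    open ≈-Reasoning
    1+n≡n+1 : + suc n ≡ + n + + 1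
    1+n≡n+1 = trans (cong +_ (ℕₚ.+-comm 1 n)) (ℤₚ.pos-+ n 1)

  fermat : ∀ x → x ℤ.^ p ≈ x
  fermat x = begin
    x ℤ.^ p             ≈⟨ ^-cong p (≈-%ℕ x) ⟩
    (+ (x %ℕ p)) ℤ.^ p  ≈⟨ fermat-ℕ (x %ℕ p) ⟩
    + (x %ℕ p)          ≈⟨ ≈-%ℕ x ⟨
    x                   ∎
    where open ≈-Reasoning

  fermat-shift : ∀ x k → x ℤ.^ (k ℕ.+ p) ≈ x ℤ.^ suc k
  fermat-shift x k = begin
    x ℤ.^ (k ℕ.+ p)     ≡⟨ ℤₚ.^-distribˡ-+-* x k p ⟩
    x ℤ.^ k * x ℤ.^ p   ≈⟨ *-cong (≈-refl {x ℤ.^ k}) (fermat x) ⟩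
    x ℤ.^ k * x         ≡⟨ ℤₚ.*-comm (x ℤ.^ k) x ⟩
    x ℤ.^ suc k         ∎
    where open ≈-Reasoning

  infix 4 _≈ˢ_
  _≈ˢ_ : Seq → Seq → Set
  u ≈ˢ v = ∀ n → u n ≈ v n

  ≈ˢ-setoid : Setoid 0ℓ 0ℓ
  ≈ˢ-setoid = record
    { Carrier       = Seq
    ; _≈_           = _≈ˢ_
    ; isEquivalence = record
      { refl  = λ _ → ≈-refl
      ; sym   = λ u≈v n → ≈-sym (u≈v n)
      ; trans = λ u≈v v≈w n → ≈-trans (u≈v n) (v≈w n)
      }
    }

  module ≈ˢ-Reasoning = SetoidReasoning ≈ˢ-setoid

  ≗⇒≈ˢ : ∀ {u v} → u ≗ v → u ≈ˢ v
  ≗⇒≈ˢ u≗v n = ≡⇒≈ (u≗v n)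

  ^∘-≈ˢ : ∀ {F} → F Preserves _≈ˢ_ ⟶ _≈ˢ_ → ∀ k → (F ^∘ k) Preserves _≈ˢ_ ⟶ _≈ˢ_
  ^∘-≈ˢ F-≈ zero    u≈v = u≈v
  ^∘-≈ˢ F-≈ (suc k) u≈v = F-≈ (^∘-≈ˢ F-≈ k u≈v)

  ^∘-≈ˢ-pointwise : ∀ {F G} → F Preserves _≈ˢ_ ⟶ _≈ˢ_ → (∀ u → F u ≈ˢ G u) →
                    ∀ k u → (F ^∘ k) u ≈ˢ (G ^∘ k) u
  ^∘-≈ˢ-pointwise F-≈ F≈G zero    u n = ≈-refl
  ^∘-≈ˢ-pointwise {F} {G} F-≈ F≈G (suc k) u n =
    ≈-trans (F-≈ (^∘-≈ˢ-pointwise F-≈ F≈G k u) n) (F≈G ((G ^∘ k) u) n)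

  shift-≈ˢ : shift Preserves _≈ˢ_ ⟶ _≈ˢ_
  shift-≈ˢ u≈v zero    = ≈-refl
  shift-≈ˢ u≈v (suc n) = u≈v n

  [1+·X^]-≈ : ∀ {c c′} d → c ≈ c′ → ∀ {u v} → u ≈ˢ v → [1+ c ·X^ d ] u ≈ˢ [1+ c′ ·X^ d ] v
  [1+·X^]-≈ d c≈c′ u≈v n = +-cong (u≈v n) (*-cong c≈c′ (^∘-≈ˢ shift-≈ˢ d u≈v n))

  [1-·X]⁻¹-≈ : ∀ {r r′} → r ≈ r′ → ∀ {u v} → u ≈ˢ v → [1- r ·X]⁻¹ u ≈ˢ [1- r′ ·X]⁻¹ v
  [1-·X]⁻¹-≈ r≈r′ u≈v zero    = u≈v zero
  [1-·X]⁻¹-≈ r≈r′ u≈v (suc n) = +-cong (u≈v (suc n)) (*-cong r≈r′ ([1-·X]⁻¹-≈ r≈r′ u≈v n))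

  divRising-≈ : ∀ {b b′} → b ≈ b′ → ∀ k {u v} → u ≈ˢ v → divRising b k u ≈ˢ divRising b′ k v
  divRising-≈ b≈b′ zero    u≈v = u≈v
  divRising-≈ b≈b′ (suc k) u≈v = [1-·X]⁻¹-≈ (+-cong b≈b′ ≈-refl) (divRising-≈ b≈b′ k u≈v)

  frobenius : ∀ c d w → ([1+ c ·X^ d ] ^∘ p) w ≈ˢ [1+ c ·X^ (p ℕ.* d) ] w
  frobenius c d w n = begin
    ([1+ c ·X^ d ] ^∘ p) w n
      ≡⟨ [1+·X^]^∘-binomial c d p w n ⟩
    binomialSum (+ 1) (λ j → c ℤ.^ j * ((shift ^∘ d) ^∘ j) w n) p
      ≈⟨ binomialSum-prime (+ 1) (λ j → c ℤ.^ j * ((shift ^∘ d) ^∘ j) w n) ⟩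
    (+ 1) ℤ.^ p * (+ 1 * w n) + c ℤ.^ p * ((shift ^∘ d) ^∘ p) w n
      ≈⟨ +-cong (≡⇒≈ first) (*-cong (fermat c) (≡⇒≈ (cong (λ f → f w n) (^∘-* shift p d)))) ⟩
    w n + c * (shift ^∘ (p ℕ.* d)) w n ∎
    where
    open ≈-Reasoning
    first : (+ 1) ℤ.^ p * (+ 1 * w n) ≡ w n
    first = trans (cong (_* (+ 1 * w n)) (ℤₚ.^-zeroˡ p))
                  (trans (ℤₚ.*-identityˡ (+ 1 * w n)) (ℤₚ.*-identityˡ (w n)))

  frobenius-^ : ∀ c d f w → [1+ c ·X^ (p ^ f ℕ.* d) ] w ≈ˢ ([1+ c ·X^ d ] ^∘ (p ^ f)) w
  frobenius-^ c d zero    w = ≗⇒≈ˢ λ n → cong (λ e → [1+ c ·X^ e ] w n) (ℕₚ.+-identityʳ d)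
  frobenius-^ c d (suc f) w = begin
    [1+ c ·X^ (p ℕ.* p ^ f ℕ.* d) ] w
      ≡⟨ cong (λ e → [1+ c ·X^ e ] w) (ℕₚ.*-assoc p (p ^ f) d) ⟩
    [1+ c ·X^ (p ℕ.* (p ^ f ℕ.* d)) ] w
      ≈⟨ frobenius c (p ^ f ℕ.* d) w ⟨
    ([1+ c ·X^ (p ^ f ℕ.* d) ] ^∘ p) w
      ≈⟨ ^∘-≈ˢ-pointwise ([1+·X^]-≈ (p ^ f ℕ.* d) (≈-refl {c})) (frobenius-^ c d f) p w ⟩
    (([1+ c ·X^ d ] ^∘ p ^ f) ^∘ p) w
      ≡⟨ cong (λ F → F w) (^∘-* [1+ c ·X^ d ] p (p ^ f)) ⟩
    ([1+ c ·X^ d ] ^∘ (p ℕ.* p ^ f)) w ∎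
    where open ≈ˢ-Reasoning

  *-cancelˡ-≈ : ∀ {n x y} → ¬ p ∣ n → + n * x ≈ + n * y → x ≈ y
  *-cancelˡ-≈ {n} {x} {y} p∤n (mod-p p∣nx-ny)
    with euclidsLemma n ℤ.∣ x - y ∣ p-prime (subst (p ∣_) (ℤₚ.abs-* (+ n) (x - y)) (Signed.∣⇒∣ᵤ p∣n[x-y]))
    where
    factor : ∀ n x y → n * x - n * y ≡ n * (x - y)
    factor = solve-∀
    p∣n[x-y] : + p Signed.∣ + n * (x - y)
    p∣n[x-y] = subst (+ p Signed.∣_) (factor (+ n) x y) p∣nx-ny
  ... | inj₁ p∣n     = ⊥-elim (p∤n p∣n)
  ... | inj₂ p∣∣x-y∣ = mod-p (Signed.∣ᵤ⇒∣ p∣∣x-y∣)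

  Δ^∘-≈ : ∀ m {g h} → (∀ y → g y ≈ h y) → ∀ x → (Δ ^∘ m) g x ≈ (Δ ^∘ m) h x
  Δ^∘-≈ zero    g≈h x = g≈h x
  Δ^∘-≈ (suc m) g≈h x = +-cong (Δ^∘-≈ m g≈h (x + + 1)) (-‿cong (Δ^∘-≈ m g≈h x))

  rStirling-periodic : ∀ b k → rStirling b p-1 (k ℕ.+ p) ≈ rStirling b p-1 (suc k)
  rStirling-periodic b k = *-cancelˡ-≈ (p∤! (ℕₚ.n<1+n p-1)) (begin
    + (p-1 !) * rStirling b p-1 (k ℕ.+ p) ≡⟨ rStirling-Δ b p-1 (k ℕ.+ p) ⟩
    (Δ ^∘ p-1) (ℤ._^ (k ℕ.+ p)) b        ≈⟨ Δ^∘-≈ p-1 (λ y → fermat-shift y k) b ⟩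
    (Δ ^∘ p-1) (ℤ._^ suc k) b            ≡⟨ rStirling-Δ b p-1 (suc k) ⟨
    + (p-1 !) * rStirling b p-1 (suc k)   ∎)
    where open ≈-Reasoning

  -- The coefficients rStirling b (p-1) (p-1+n) of the series below are 1, 0, …, 0 and then
  -- repeat with period p - 1.
  module _ (b : ℤ) where
    private
      V : Seq
      V = divRising b p one
      t : ℕ → ℤ
      t = rStirling b p-1
      V≡t : ∀ n → V n ≡ t (p-1 ℕ.+ n)
      V≡t = divRising-rStirling b p-1

    [1-X^p-1]-divRising : [1-X^ p-1 ] (divRising b p one) ≈ˢ one
    [1-X^p-1]-divRising n with n ℕ.<? p-1
    ... | yes n<p-1 = begin
      V n + -1ℤ * (shift ^∘ p-1) V n ≡⟨ cong (λ y → V n + -1ℤ * y) (shift^∘-below V n<p-1) ⟩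
      V n + -1ℤ * + 0                ≡⟨ trans (cong (_+_ (V n)) (ℤₚ.*-zeroʳ -1ℤ)) (ℤₚ.+-identityʳ (V n)) ⟩
      V n                            ≈⟨ V≈one n<p-1 ⟩
      one n                          ∎
      where
      open ≈-Reasoning
      p-1+[1+j]≡j+p : ∀ j → p-1 ℕ.+ suc j ≡ j ℕ.+ p
      p-1+[1+j]≡j+p j = trans (ℕₚ.+-suc p-1 j) (trans (cong suc (ℕₚ.+-comm p-1 j)) (sym (ℕₚ.+-suc j p-1)))
      V≈one : ∀ {n} → n < p-1 → V n ≈ one n
      V≈one {zero}  _         = ≡⇒≈ (trans (V≡t 0) (trans (cong t (ℕₚ.+-identityʳ p-1)) (rStirling-diag b p-1)))
      V≈one {suc j} j+1<p-1 = begin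
        V (suc j)          ≡⟨ trans (V≡t (suc j)) (cong t (p-1+[1+j]≡j+p j)) ⟩
        t (j ℕ.+ p)        ≈⟨ rStirling-periodic b j ⟩
        t (suc j)          ≡⟨ rStirling-below b j+1<p-1 ⟩
        + 0                ∎
    ... | no n≮p-1 with j , refl ← ℕₚ.m≤n⇒∃[o]m+o≡n (ℕₚ.≮⇒≥ n≮p-1) = begin
      V (p-1 ℕ.+ j) + -1ℤ * (shift ^∘ p-1) V (p-1 ℕ.+ j)
        ≡⟨ cong (λ y → V (p-1 ℕ.+ j) + -1ℤ * y) (shift^∘-+ p-1 V j) ⟩
      V (p-1 ℕ.+ j) + -1ℤ * V j
        ≡⟨ cong (λ y → y + -1ℤ * V j) (trans (V≡t (p-1 ℕ.+ j)) (cong t (rearrange p-2 j))) ⟩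
      t ((p-2 ℕ.+ j) ℕ.+ p) + -1ℤ * V j
        ≈⟨ +-cong (rStirling-periodic b (p-2 ℕ.+ j)) ≈-refl ⟩
      t (p-1 ℕ.+ j) + -1ℤ * V j
        ≡⟨ cong (λ y → t (p-1 ℕ.+ j) + -1ℤ * y) (V≡t j) ⟩
      t (p-1 ℕ.+ j) + -1ℤ * t (p-1 ℕ.+ j)
        ≡⟨ cancel (t (p-1 ℕ.+ j)) ⟩
      + 0 ∎
      where
      open ≈-Reasoning
      cancel : ∀ x → x + -1ℤ * x ≡ + 0
      cancel = solve-∀
      rearrange : ∀ a j → suc a ℕ.+ (suc a ℕ.+ j) ≡ (a ℕ.+ j) ℕ.+ suc (suc a)
      rearrange = ℕ-Solver.solve-∀

  [1-X^p-1]^∘-divRising : ∀ b j → ([1-X^ p-1 ] ^∘ j) (divRising b (p ℕ.* j) one) ≈ˢ one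
  [1-X^p-1]^∘-divRising b zero    = ≗⇒≈ˢ λ n → cong (λ k → divRising b k one n) (ℕₚ.*-zeroʳ p)
  [1-X^p-1]^∘-divRising b (suc j) = begin
    ([1-X^ p-1 ] ^∘ suc j) (divRising b (p ℕ.* suc j) one)
      ≡⟨ ^∘-suc [1-X^ p-1 ] j (divRising b (p ℕ.* suc j) one) ⟩
    ([1-X^ p-1 ] ^∘ j) ([1-X^ p-1 ] (divRising b (p ℕ.* suc j) one))
      ≈⟨ ^∘-≈ˢ [1-X^p-1]-≈ j (≗⇒≈ˢ split) ⟩
    ([1-X^ p-1 ] ^∘ j) (divRising (b + + p) (p ℕ.* j) ([1-X^ p-1 ] (divRising b p one)))
      ≈⟨ ^∘-≈ˢ [1-X^p-1]-≈ j (divRising-≈ (≈-refl {b + + p}) (p ℕ.* j) ([1-X^p-1]-divRising b)) ⟩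
    ([1-X^ p-1 ] ^∘ j) (divRising (b + + p) (p ℕ.* j) one)
      ≈⟨ [1-X^p-1]^∘-divRising (b + + p) j ⟩
    one ∎
    where
    open ≈ˢ-Reasoning
    [1-X^p-1]-≈ : [1-X^ p-1 ] Preserves _≈ˢ_ ⟶ _≈ˢ_
    [1-X^p-1]-≈ = [1+·X^]-≈ p-1 (≈-refl { -1ℤ})
    [1-X^p-1]-lin : IsXLinear [1-X^ p-1 ]
    [1-X^p-1]-lin = [1+·X^]-isXLinear -1ℤ p-1
    split : [1-X^ p-1 ] (divRising b (p ℕ.* suc j) one) ≗ divRising (b + + p) (p ℕ.* j) ([1-X^ p-1 ] (divRising b p one))
    split n = trans
      (≗-cong [1-X^p-1]-lin (λ i → trans (cong (λ k → divRising b k one i) (ℕₚ.*-suc p j))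
                                         (divRising-+ b p (p ℕ.* j) one i)) n)
      (commutes-divRising [1-X^p-1]-lin (b + + p) (p ℕ.* j) (divRising b p one) n)

  [1-X^N]-divRising : ∀ b f → [1-X^ (p-1 ℕ.* p ^ f) ] (divRising b (p ^ suc f) one) ≈ˢ one
  [1-X^N]-divRising b f = begin
    [1-X^ (p-1 ℕ.* p ^ f) ] (divRising b (p ^ suc f) one)
      ≡⟨ cong (λ d → [1-X^ d ] (divRising b (p ^ suc f) one)) (ℕₚ.*-comm p-1 (p ^ f)) ⟩
    [1-X^ (p ^ f ℕ.* p-1) ] (divRising b (p ^ suc f) one)
      ≈⟨ frobenius-^ -1ℤ p-1 f (divRising b (p ^ suc f) one) ⟩
    ([1-X^ p-1 ] ^∘ p ^ f) (divRising b (p ℕ.* p ^ f) one)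
      ≈⟨ [1-X^p-1]^∘-divRising b (p ^ f) ⟩
    one ∎
    where open ≈ˢ-Reasoning

  -- Degree bounds modulo p

  nonMultiples : ℕ → ℕ → ℕ
  nonMultiples c zero    = 0
  nonMultiples c (suc k) with p ∣? c
  ... | yes _ = nonMultiples (suc c) k
  ... | no  _ = suc (nonMultiples (suc c) k)

  nonMultiples-+ : ∀ c k l → nonMultiples c (k ℕ.+ l) ≡ nonMultiples c k ℕ.+ nonMultiples (c ℕ.+ k) l
  nonMultiples-+ c zero    l = cong (λ c′ → nonMultiples c′ l) (sym (ℕₚ.+-identityʳ c))
  nonMultiples-+ c (suc k) l rewrite ℕₚ.+-suc c k with p ∣? c
  ... | yes _ = nonMultiples-+ (suc c) k l
  ... | no  _ = cong suc (nonMultiples-+ (suc c) k l)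

  nonMultiples-≤ : ∀ c k → nonMultiples c k ≤ k
  nonMultiples-≤ c zero    = z≤n
  nonMultiples-≤ c (suc k) with p ∣? c
  ... | yes _ = ℕₚ.m≤n⇒m≤1+n (nonMultiples-≤ (suc c) k)
  ... | no  _ = s≤s (nonMultiples-≤ (suc c) k)

  nonMultiples-< : ∀ c {i k} → i < k → p ∣ c ℕ.+ i → nonMultiples c k < k
  nonMultiples-< c {i} {suc k} (s≤s i≤k) p∣c+i with p ∣? c | i
  ... | yes _   | _      = s≤s (nonMultiples-≤ (suc c) k)
  ... | no  p∤c | zero   = ⊥-elim (p∤c (subst (p ∣_) (ℕₚ.+-identityʳ c) p∣c+i))
  ... | no  _   | suc i′ = s≤s (nonMultiples-< (suc c) i≤k (subst (p ∣_) (ℕₚ.+-suc c i′) p∣c+i))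

  multiple-within-p : ∀ c → ∃[ i ] i < p × p ∣ c ℕ.+ i
  multiple-within-p zero    = 0 , z<s , (p ∣0)
  multiple-within-p (suc c) with multiple-within-p c
  ... | suc i , i+1<p , p∣c+i+1 = i , ℕₚ.<-trans (ℕₚ.n<1+n i) i+1<p , subst (p ∣_) (ℕₚ.+-suc c i) p∣c+i+1
  ... | zero  , _     , p∣c+0   =
    p-1 , ℕₚ.n<1+n p-1 , subst (p ∣_) (ℕₚ.+-suc c p-1) (∣m∣n⇒∣m+n p∣c (∣-refl {p}))
    where
    p∣c : p ∣ c
    p∣c = subst (p ∣_) (ℕₚ.+-identityʳ c) p∣c+0

  nonMultiples-p : ∀ c → nonMultiples c p ≤ p-1
  nonMultiples-p c with i , i<p , p∣c+i ← multiple-within-p c = ℕₚ.≤-pred (nonMultiples-< c i<p p∣c+i)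

  nonMultiples-p* : ∀ c K → nonMultiples c (p ℕ.* K) ≤ p-1 ℕ.* K
  nonMultiples-p* c zero    =
    ℕₚ.≤-reflexive (trans (cong (nonMultiples c) (ℕₚ.*-zeroʳ p)) (sym (ℕₚ.*-zeroʳ p-1)))
  nonMultiples-p* c (suc K) = begin
    nonMultiples c (p ℕ.* suc K)
      ≡⟨ cong (nonMultiples c) (ℕₚ.*-suc p K) ⟩
    nonMultiples c (p ℕ.+ p ℕ.* K)
      ≡⟨ nonMultiples-+ c p (p ℕ.* K) ⟩
    nonMultiples c p ℕ.+ nonMultiples (c ℕ.+ p) (p ℕ.* K)
      ≤⟨ ℕₚ.+-mono-≤ (nonMultiples-p c) (nonMultiples-p* (c ℕ.+ p) K) ⟩
    p-1 ℕ.+ p-1 ℕ.* K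
      ≡⟨ ℕₚ.*-suc p-1 K ⟨
    p-1 ℕ.* suc K ∎
    where open ℕₚ.≤-Reasoning

  nonMultiples-2 : ∀ c → 1 ≤ nonMultiples c 2
  nonMultiples-2 c with p ∣? c
  ... | no  _   = s≤s z≤n
  ... | yes p∣c with p ∣? suc c
  ...   | no  _     = s≤s z≤n
  ...   | yes p∣c+1 with () ← ∣1⇒≡1 (∣m+n∣m⇒∣n (subst (p ∣_) (ℕₚ.+-comm 1 c) p∣c+1) p∣c)

  mulRising-≈ : ∀ b k → mulRising b k Preserves _≈ˢ_ ⟶ _≈ˢ_
  mulRising-≈ b zero    u≈v = u≈v
  mulRising-≈ b (suc k) u≈v = [1+·X^]-≈ 1 (≈-refl { - (b + + k)}) (mulRising-≈ b k u≈v)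

  Degree< : ℕ → Seq → Set
  Degree< d v = ∀ {n} → d ≤ n → v n ≈ + 0

  Degree<-mono : ∀ {d d′ v} → d ≤ d′ → Degree< d v → Degree< d′ v
  Degree<-mono d≤d′ deg d′≤n = deg (ℕₚ.≤-trans d≤d′ d′≤n)

  Degree<-≈ˢ : ∀ {d u v} → u ≈ˢ v → Degree< d v → Degree< d u
  Degree<-≈ˢ u≈v deg {n} d≤n = ≈-trans (u≈v n) (deg d≤n)

  one-Degree< : Degree< 1 one
  one-Degree< {suc n} _ = ≈-refl

  [1-·X]-Degree< : ∀ c {d v} → Degree< d v → Degree< (nonMultiples c 1 ℕ.+ d) ([1- + c ·X] v)
  [1-·X]-Degree< c {d} {v} deg {n} d≤n with p ∣? c
  [1-·X]-Degree< c {d} {v} deg {n}     d≤n       | yes p∣c =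
    +-cong (deg d≤n) (*-zeroˡ-≈ (shift v n) (-‿cong (∣⇒≈0 p∣c)))
  [1-·X]-Degree< c {d} {v} deg {suc n} (s≤s d≤n) | no _    =
    +-cong (deg (ℕₚ.m≤n⇒m≤1+n d≤n))
           (≈-trans (*-cong (≈-refl { - + c}) (deg d≤n)) (≡⇒≈ (ℤₚ.*-zeroʳ (- + c))))

  mulRising-Degree< : ∀ c k {d v} → Degree< d v → Degree< (nonMultiples c k ℕ.+ d) (mulRising (+ c) k v)
  mulRising-Degree< c zero    deg = deg
  mulRising-Degree< c (suc k) {d} {v} deg =
    Degree<-≈ˢ (≗⇒≈ˢ λ n → cong (λ r → [1- r ·X] (mulRising (+ c) k v) n) (ℤₚ.pos-+ c k))
      (Degree<-mono (ℕₚ.≤-reflexive count) ([1-·X]-Degree< (c ℕ.+ k) (mulRising-Degree< c k deg)))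
    where
    count : nonMultiples (c ℕ.+ k) 1 ℕ.+ (nonMultiples c k ℕ.+ d) ≡ nonMultiples c (suc k) ℕ.+ d
    count = begin
      nonMultiples (c ℕ.+ k) 1 ℕ.+ (nonMultiples c k ℕ.+ d)
        ≡⟨ ℕₚ.+-assoc (nonMultiples (c ℕ.+ k) 1) (nonMultiples c k) d ⟨
      nonMultiples (c ℕ.+ k) 1 ℕ.+ nonMultiples c k ℕ.+ d
        ≡⟨ cong (ℕ._+ d) (ℕₚ.+-comm (nonMultiples (c ℕ.+ k) 1) (nonMultiples c k)) ⟩
      nonMultiples c k ℕ.+ nonMultiples (c ℕ.+ k) 1 ℕ.+ d
        ≡⟨ cong (ℕ._+ d) (nonMultiples-+ c k 1) ⟨
      nonMultiples c (k ℕ.+ 1) ℕ.+ d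
        ≡⟨ cong (λ i → nonMultiples c i ℕ.+ d) (ℕₚ.+-comm k 1) ⟩
      nonMultiples c (suc k) ℕ.+ d ∎
      where open ≡-Reasoning

  [1-X^]-Degree<⇒periodic : ∀ N U → Degree< N ([1-X^ N ] U) → ∀ q → U (N ℕ.* q) ≈ U 0
  [1-X^]-Degree<⇒periodic N U deg zero    = ≡⇒≈ (cong U (ℕₚ.*-zeroʳ N))
  [1-X^]-Degree<⇒periodic N U deg (suc q) = begin
    U (N ℕ.* suc q)
      ≡⟨ cong U (ℕₚ.*-suc N q) ⟩
    U (N ℕ.+ N ℕ.* q)
      ≡⟨ rearrange (U (N ℕ.+ N ℕ.* q)) (U (N ℕ.* q)) ⟩
    (U (N ℕ.+ N ℕ.* q) + -1ℤ * U (N ℕ.* q)) + U (N ℕ.* q)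
      ≡⟨ cong (λ y → (U (N ℕ.+ N ℕ.* q) + -1ℤ * y) + U (N ℕ.* q)) (shift^∘-+ N U (N ℕ.* q)) ⟨
    [1-X^ N ] U (N ℕ.+ N ℕ.* q) + U (N ℕ.* q)
      ≈⟨ +-cong (deg (ℕₚ.m≤m+n N (N ℕ.* q))) (≈-refl {U (N ℕ.* q)}) ⟩
    + 0 + U (N ℕ.* q)
      ≡⟨ ℤₚ.+-identityˡ (U (N ℕ.* q)) ⟩
    U (N ℕ.* q)
      ≈⟨ [1-X^]-Degree<⇒periodic N U deg q ⟩
    U 0 ∎
    where
    open ≈-Reasoning
    rearrange : ∀ x y → x ≡ (x + -1ℤ * y) + y
    rearrange = solve-∀

  [1-X^]-divRising-split : ∀ N b k l → [1-X^ N ] (divRising b (k ℕ.+ l) one) ≈ˢ one →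
                           [1-X^ N ] (divRising b k one) ≈ˢ mulRising (b + + k) l one
  [1-X^]-divRising-split N b k l [1-X^N]W≈1 = begin
    [1-X^ N ] U
      ≈⟨ ≗⇒≈ˢ (≗-cong [1-X^N]-lin (λ n → sym (mulRising∘divRising b′ l U n))) ⟩
    [1-X^ N ] (mulRising b′ l (divRising b′ l U))
      ≈⟨ ≗⇒≈ˢ (commutes-mulRising [1-X^N]-lin b′ l (divRising b′ l U)) ⟩
    mulRising b′ l ([1-X^ N ] (divRising b′ l U))
      ≈⟨ mulRising-≈ b′ l (≗⇒≈ˢ (≗-cong [1-X^N]-lin (λ n → sym (divRising-+ b k l one n)))) ⟩
    mulRising b′ l ([1-X^ N ] (divRising b (k ℕ.+ l) one))
      ≈⟨ mulRising-≈ b′ l [1-X^N]W≈1 ⟩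
    mulRising b′ l one ∎
    where
    open ≈ˢ-Reasoning
    b′ : ℤ
    b′ = b + + k
    U : Seq
    U = divRising b k one
    [1-X^N]-lin : IsXLinear [1-X^ N ]
    [1-X^N]-lin = [1+·X^]-isXLinear -1ℤ N

  divRising-periodic : ∀ c k f → k ≤ p ^ suc f → nonMultiples (c ℕ.+ k) (p ^ suc f ∸ k) < p-1 ℕ.* p ^ f →
                       ∀ q → divRising (+ c) k one (p-1 ℕ.* p ^ f ℕ.* q) ≈ + 1
  divRising-periodic c k f k≤p^f+1 few q =
    ≈-trans ([1-X^]-Degree<⇒periodic N (divRising (+ c) k one) deg q) (≡⇒≈ (divRising-head (+ c) k one))
    where
    N r : ℕ
    N = p-1 ℕ.* p ^ f
    r = p ^ suc f ∸ k
    [1-X^N]W≈1 : [1-X^ N ] (divRising (+ c) (k ℕ.+ r) one) ≈ˢ one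
    [1-X^N]W≈1 n = ≈-trans (≡⇒≈ (cong (λ i → [1-X^ N ] (divRising (+ c) i one) n) (ℕₚ.m+[n∸m]≡n k≤p^f+1)))
                           ([1-X^N]-divRising (+ c) f n)
    [1-X^N]U≈ : [1-X^ N ] (divRising (+ c) k one) ≈ˢ mulRising (+ (c ℕ.+ k)) r one
    [1-X^N]U≈ n = ≈-trans ([1-X^]-divRising-split N (+ c) k r [1-X^N]W≈1 n)
                          (≡⇒≈ (cong (λ b → mulRising b r one n) (ℤₚ.pos-+ c k)))
    deg : Degree< N ([1-X^ N ] (divRising (+ c) k one))
    deg = Degree<-≈ˢ [1-X^N]U≈
      (Degree<-mono (ℕₚ.≤-trans (ℕₚ.≤-reflexive (ℕₚ.+-comm (nonMultiples (c ℕ.+ k) r) 1)) few)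
                    (mulRising-Degree< (c ℕ.+ k) r one-Degree<))

  nonMultiples-tail< : ∀ c {k} e → 2 ≤ k → k ≤ p ^ suc e →
                       nonMultiples (c ℕ.+ k) (p ^ suc e ∸ k) < p-1 ℕ.* p ^ e
  nonMultiples-tail< c {k@(suc (suc j))} e (s≤s (s≤s z≤n)) k≤p^1+e = begin
    suc (nonMultiples (c ℕ.+ k) r)                        ≤⟨ ℕₚ.+-monoˡ-≤ (nonMultiples (c ℕ.+ k) r) 1≤nonMultiples ⟩
    nonMultiples c k ℕ.+ nonMultiples (c ℕ.+ k) r         ≡⟨ nonMultiples-+ c k r ⟨
    nonMultiples c (k ℕ.+ r)                              ≡⟨ cong (nonMultiples c) (ℕₚ.m+[n∸m]≡n k≤p^1+e) ⟩
    nonMultiples c (p ℕ.* p ^ e)                          ≤⟨ nonMultiples-p* c (p ^ e) ⟩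
    p-1 ℕ.* p ^ e                                         ∎
    where
    open ℕₚ.≤-Reasoning
    r : ℕ
    r = p ^ suc e ∸ k
    1≤nonMultiples : 1 ≤ nonMultiples c k
    1≤nonMultiples = ℕₚ.≤-trans (nonMultiples-2 c)
      (ℕₚ.≤-trans (ℕₚ.m≤m+n (nonMultiples c 2) _) (ℕₚ.≤-reflexive (sym (nonMultiples-+ c 2 j))))

  stirlingSum-periodic : ∀ a m → 1 ≤ m → ∀ e → m < p ^ suc e → ∀ q →
                         stirlingSum a m (m ℕ.+ p-1 ℕ.* p ^ e ℕ.* q) ≈ + 1
  stirlingSum-periodic a m 1≤m e m<p^1+e q = begin
    stirlingSum a m (m ℕ.+ N ℕ.* q)
      ≡⟨ stirlingSum-divRising a m (N ℕ.* q) ⟩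
    divRising a (suc m) one (N ℕ.* q)
      ≈⟨ divRising-≈ (≈-%ℕ a) (suc m) (λ _ → ≈-refl) (N ℕ.* q) ⟩
    divRising (+ c) (suc m) one (N ℕ.* q)
      ≈⟨ divRising-periodic c (suc m) e m<p^1+e (nonMultiples-tail< c e (s≤s 1≤m) m<p^1+e) q ⟩
    + 1 ∎
    where
    open ≈-Reasoning
    N c : ℕ
    N = p-1 ℕ.* p ^ e
    c = a %ℕ p

  stirlingSum-periodic-p∣a : ∀ a f → p ∣ ℤ.∣ a ∣ → ∀ q →
                             stirlingSum a (p ^ suc f) (p ^ suc f ℕ.+ p-1 ℕ.* p ^ f ℕ.* q) ≈ + 1
  stirlingSum-periodic-p∣a a f p∣a q = begin
    stirlingSum a M (M ℕ.+ N ℕ.* q)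
      ≡⟨ stirlingSum-divRising a M (N ℕ.* q) ⟩
    divRising a (suc M) one (N ℕ.* q)
      ≈⟨ divRising-≈ a≈0 (suc M) (λ _ → ≈-refl) (N ℕ.* q) ⟩
    divRising (+ 0) (suc M) one (N ℕ.* q)
      ≡⟨ divRising-+ (+ 0) 1 M one (N ℕ.* q) ⟩
    divRising (+ 1) M (divRising (+ 0) 1 one) (N ℕ.* q)
      ≡⟨ ≗-cong (divRising-isXLinear (+ 1) M) [1-0·X]⁻¹-one (N ℕ.* q) ⟩
    divRising (+ 1) M one (N ℕ.* q)
      ≈⟨ divRising-periodic 1 M f ℕₚ.≤-refl few q ⟩
    + 1 ∎
    where
    open ≈-Reasoning
    M N : ℕ
    M = p ^ suc f
    N = p-1 ℕ.* p ^ f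
    a≈0 : a ≈ + 0
    a≈0 = ≈-from (Signed.∣ᵤ⇒∣ p∣a) (sym (ℤₚ.+-identityʳ a))
    few : nonMultiples (1 ℕ.+ M) (M ∸ M) < N
    few = subst (λ i → nonMultiples (1 ℕ.+ M) i < N) (sym (ℕₚ.n∸n≡0 M))
                (ℕₚ.<-≤-trans (ℕₚ.m^n>0 p f) (ℕₚ.m≤m+n (p ^ f) (p-2 ℕ.* p ^ f)))

  stirlingSum≈1 : ∀ a m → 1 ≤ m → ∀ e → m < p ^ suc e → ∀ q →
                  stirlingSum a m (m ℕ.+ p-1 ℕ.* p ^ (e ∸ δ p a m e) ℕ.* q) ≈ + 1
  stirlingSum≈1 a m 1≤m e m<p^1+e q with p ∣? ℤ.∣ a ∣ | m ℕ.≟ p ^ e | 1 ℕ.≤? e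
  ... | yes p∣a | yes refl | yes (s≤s {n = f} z≤n) = stirlingSum-periodic-p∣a a f p∣a q
  ... | no  _   | _        | _     = stirlingSum-periodic a m 1≤m e m<p^1+e q
  ... | yes _   | no  _    | _     = stirlingSum-periodic a m 1≤m e m<p^1+e q
  ... | yes _   | yes _    | no  _ = stirlingSum-periodic a m 1≤m e m<p^1+e q

open import Data.Integer.Divisibility using (_∣_)

corollary1p1 : (p : ℕ) → Prime p → (a : ℤ) → (m : ℕ) → 1 ≤ m →
    (e : ℕ) → p ^ e ≤ m → m < p ^ suc e →
    (q : ℕ) →
    let k = m ℕ.+ (p ∸ 1) ℕ.* p ^ (e ∸ δ p a m e) ℕ.* q in
    (+ p) ∣ (stirlingSum a m k ℤ.- + 1)
corollary1p1 zero            p-prime _ _ _   _ _ _       _ = ⊥-elim (¬prime[0] p-prime)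
corollary1p1 (suc zero)      p-prime _ _ _   _ _ _       _ = ⊥-elim (¬prime[1] p-prime)
corollary1p1 (suc (suc p-2)) p-prime a m 1≤m e _ m<p^1+e q =
  Signed.∣⇒∣ᵤ (_≈_.p∣x-y (stirlingSum≈1 p-prime a m 1≤m e m<p^1+e q))
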